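{- Let $r,s,l$ be integers with $r,s,l \geq 2$. Then there exist an integer $n > l$ and a graph $\mathcal{G}$ with vertex set $[n]$ such that $\chi\left(\mathrm{KG}^r(\mathcal{G}_{s\text{ -stable}})\right) = 0$ and $\left\lceil \frac{\mathrm{cd}^s(\mathcal{G})}{r-1} \right\rceil \geq 1$.
   Context: $[n]=\{1,\dots,n\}$. A hypergraph $\mathcal{H}$ on vertex set $V$ is a family $E(\mathcal{H})$ of nonempty subsets of $V$ (hyperedges); a graph is a hypergraph all of whose hyperedges have size 2. A set $S \subseteq [n]$ is $s$-stable if any two distinct $i,j \in S$ satisfy $s \leq |i-j| \leq n-s$. For a hypergraph $\mathcal{H}$ on $[n]$, $\mathcal{H}_{s\text{ -stable}}$ denotes the hypergraph on $[n]$ whose hyperedges are the $s$-stable hyperedges of $\mathcal{H}$. For a hypergraph $\mathcal{F}$ and $r\ge 2$, the general Kneser hypergraph $\mathrm{KG}^r(\mathcal{F})$ has vertex set $E(\mathcal{F})$, and its hyperedges are the sets of $r$ pairwise disjoint hyperedges of $\mathcal{F}$. The chromatic number $\chi$ of a hypergraph is the least number of colors in a vertex coloring with no monochromatic hyperedge (it is $0$ when the vertex set is empty). For $t\ge 2$, the $t$-colorability defect $\mathrm{cd}^t(\mathcal{H})$ is the minimum size of a set $S \subseteq V(\mathcal{H})$ such that the induced subhypergraph on $V(\mathcal{H})\setminus S$ (whose hyperedges are the hyperedges of $\mathcal{H}$ contained in $V(\mathcal{H})\setminus S$) admits a vertex coloring with at most $t$ colors having no monochromatic hyperedge. -}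

module Defs where

open import Level using (0ℓ)
open import Data.Nat using (ℕ; zero; suc; _+_; _∸_; _≤_; _<_; _/_; ∣_-_∣)
open import Data.Fin using (Fin; toℕ)
open import Data.Fin.Subset using (Subset; _∈_; _∉_; ∣_∣; Nonempty)
open import Data.Product using (Σ; ∃; _×_; _,_)
open import Relation.Nullary using (¬_)
open import Relation.Binary.PropositionalEquality using (_≡_; _≢_)

-- Hypergraphs on the vertex set [n], represented as Fin n
-- (vertex i : Fin n stands for the integer toℕ i + 1 ∈ [n]).
-- A hypergraph is given by the predicate "e is a hyperedge" on subsets.

record FinHypergraph (n : ℕ) : Set₁ where
  field
    IsEdge   : Subset n → Set
    nonempty : ∀ e → IsEdge e → Nonempty e
open FinHypergraph public

IsGraph : ∀ {n} → FinHypergraph n → Set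
IsGraph {n} H = ∀ e → IsEdge H e → ∣ e ∣ ≡ 2

Stable : (n s : ℕ) → Subset n → Set
Stable n s S = ∀ i j → i ∈ S → j ∈ S → i ≢ j →
  (s ≤ ∣ toℕ i - toℕ j ∣) × (∣ toℕ i - toℕ j ∣ ≤ n ∸ s)

stablePart : ∀ {n} → ℕ → FinHypergraph n → FinHypergraph n
stablePart {n} s H = record
  { IsEdge   = λ e → IsEdge H e × Stable n s e
  ; nonempty = λ { e (p , _) → nonempty H e p } }

-- General hypergraphs (needed for Kneser hypergraphs), given by a vertex
-- type, an index type of hyperedges and a membership relation.

record Hypergraph : Set₁ where
  field
    Vertex : Set
    Edge   : Set
    _∈ₑ_   : Vertex → Edge → Set
open Hypergraph public

ProperColouring : (H : Hypergraph) (k : ℕ) → (Vertex H → Fin k) → Set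
ProperColouring H k c =
  ∀ (e : Edge H) → ¬ (∃ λ (col : Fin k) → ∀ v → _∈ₑ_ H v e → c v ≡ col)

Colourable : Hypergraph → ℕ → Set
Colourable H k = ∃ λ (c : Vertex H → Fin k) → ProperColouring H k c

IsChromaticNumber : Hypergraph → ℕ → Set
IsChromaticNumber H k = Colourable H k × (∀ m → m < k → ¬ Colourable H m)

DisjointSub : ∀ {n} → Subset n → Subset n → Set
DisjointSub {n} A B = ∀ (i : Fin n) → i ∈ A → i ∉ B

-- General Kneser hypergraph KG^r(F): vertices are hyperedges of F;
-- hyperedges are the sets {f 0, …, f (r-1)} of r pairwise disjoint
-- hyperedges of F (pairwise disjointness of nonempty sets forces them
-- to be distinct, so such a set has exactly r elements).
KG : ∀ {n} → ℕ → FinHypergraph n → Hypergraph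
KG {n} r F = record
  { Vertex = Σ (Subset n) (IsEdge F)
  ; Edge   = Σ (Fin r → Σ (Subset n) (IsEdge F)) (λ f →
               ∀ i j → i ≢ j → DisjointSub (Σ.proj₁ (f i)) (Σ.proj₁ (f j)))
  ; _∈ₑ_   = λ v e → ∃ λ i → Σ.proj₁ e i ≡ v }

-- the induced subhypergraph on [n] \ S admits a proper t-colouring
-- (a colouring is a function on the vertices outside S; the hyperedges
-- of the induced subhypergraph are the hyperedges disjoint from S)
InducedColourable : ∀ {n} → FinHypergraph n → ℕ → Subset n → Set
InducedColourable {n} H t S =
  ∃ λ (c : (i : Fin n) → i ∉ S → Fin t) →
    ∀ e → IsEdge H e → (d : DisjointSub e S) →
      ¬ (∃ λ (col : Fin t) → ∀ i → (p : i ∈ e) → c i (d i p) ≡ col)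

IsColourabilityDefect : ∀ {n} → FinHypergraph n → ℕ → ℕ → Set
IsColourabilityDefect {n} H t d =
  (∃ λ (S : Subset n) → ∣ S ∣ ≡ d × InducedColourable H t S) ×
  (∀ (S : Subset n) → InducedColourable H t S → d ≤ ∣ S ∣)

-- ceiling division; the divisor 0 case is junk (never used: r - 1 ≥ 1)
⌈_/_⌉ : ℕ → ℕ → ℕ
⌈ a / zero ⌉ = 0
⌈ a / suc b ⌉ = (a + b) / suc b

{-# OPTIONS --safe #-}
-- Take the vertices 0, …, ks with k = l + 1, and join every pair that is not
-- s-stable.  Then the s-stable part of G has no edges, so its Kneser
-- hypergraph is empty and has chromatic number 0.  Deleting the vertex ks
-- leaves a graph properly coloured by residues mod s: two vertices below ks
-- with equal residue are at distance js with 1 ≤ j ≤ k - 1, which lies between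
-- s and (ks + 1) - s.  But G itself has no proper s-colouring: the colouring
-- would be s-periodic, giving 0 and ks, which are adjacent across
-- the wrap-around, the same colour.  So cd^s(G) = 1 and ⌈1/(r-1)⌉ = 1.
module Submission where

open import Defs
open import Data.Nat using (ℕ; _≤_; _<_; _∸_)
open import Data.Product using (Σ; ∃; _×_)

open import Data.Empty using (⊥-elim)
open import Data.Fin using (Fin; zero; suc; toℕ; fromℕ)
open import Data.Fin.Properties using (toℕ-injective; toℕ-fromℕ; toℕ-fromℕ<; toℕ≤pred[n]; pigeonhole)
open import Data.Fin.Subset using (_∈_; _∉_; ∣_∣; ⁅_⁆; _∪_)
  renaming (⊥ to ∅)
open import Data.Fin.Subset.Properties
  using (x∈⁅x⁆; x∈⁅y⁆⇒x≡y; x∉⁅y⁆⇒x≢y; ∣⁅x⁆∣≡1; ∉⊥; x∈p∪q⁺; x∈p∪q⁻;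
         ∪-identityˡ; ∪-identityʳ; p⊆q⇒∣p∣≤∣q∣; nonempty?; Empty-unique)
open import Data.Nat using (zero; suc; _+_; _*_; z≤n; s≤s; s≤s⁻¹; ∣_-_∣; _%_; _/_; NonZero; >-nonZero)
open import Data.Nat.DivMod using (m≡m%n+[m/n]*n; m<n⇒m%n≡m; m%n<n; n/n≡1; _mod_)
open import Data.Nat.Divisibility using (_∣_; divides; divides-refl; ∣⇒≤)
open import Data.Nat.Properties
open import Data.Product using (∃₂; _,_; proj₂)
open import Data.Sum using (_⊎_; inj₁; inj₂; [_,_])
open import Function using (_∘_)
open import Relation.Binary.Definitions using (tri<; tri≈; tri>)
open import Relation.Binary.PropositionalEquality using (_≡_; _≢_; refl; sym; trans; cong; cong₂; subst; subst₂; module ≡-Reasoning)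
open import Relation.Nullary using (¬_; yes; no)

∣⁅x⁆∪⁅y⁆∣≡2 : ∀ {n} {x y : Fin n} → x ≢ y → ∣ ⁅ x ⁆ ∪ ⁅ y ⁆ ∣ ≡ 2
∣⁅x⁆∪⁅y⁆∣≡2 {x = zero}  {zero}  x≢y = ⊥-elim (x≢y refl)
∣⁅x⁆∪⁅y⁆∣≡2 {x = zero}  {suc y} _   = cong suc (trans (cong ∣_∣ (∪-identityˡ ⁅ y ⁆)) (∣⁅x⁆∣≡1 y))
∣⁅x⁆∪⁅y⁆∣≡2 {x = suc x} {zero}  _   = cong suc (trans (cong ∣_∣ (∪-identityʳ ⁅ x ⁆)) (∣⁅x⁆∣≡1 x))
∣⁅x⁆∪⁅y⁆∣≡2 {x = suc x} {suc y} x≢y = ∣⁅x⁆∪⁅y⁆∣≡2 (x≢y ∘ cong suc)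

x∈⁅x⁆∪⁅y⁆ : ∀ {n} (x y : Fin n) → x ∈ ⁅ x ⁆ ∪ ⁅ y ⁆
x∈⁅x⁆∪⁅y⁆ x y = x∈p∪q⁺ (inj₁ (x∈⁅x⁆ x))

y∈⁅x⁆∪⁅y⁆ : ∀ {n} (x y : Fin n) → y ∈ ⁅ x ⁆ ∪ ⁅ y ⁆
y∈⁅x⁆∪⁅y⁆ x y = x∈p∪q⁺ {p = ⁅ x ⁆} (inj₂ (x∈⁅x⁆ y))

∈⁅x⁆∪⁅y⁆⇒≡ : ∀ {n} {z} (x y : Fin n) → z ∈ ⁅ x ⁆ ∪ ⁅ y ⁆ → z ≡ x ⊎ z ≡ y
∈⁅x⁆∪⁅y⁆⇒≡ x y z∈ with x∈p∪q⁻ ⁅ x ⁆ ⁅ y ⁆ z∈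
... | inj₁ z∈⁅x⁆ = inj₁ (x∈⁅y⁆⇒x≡y x z∈⁅x⁆)
... | inj₂ z∈⁅y⁆ = inj₂ (x∈⁅y⁆⇒x≡y y z∈⁅y⁆)

graphOf : ∀ {n} → (Fin n → Fin n → Set) → FinHypergraph n
graphOf R = record
  { IsEdge   = λ e → ∃₂ λ a b → a ≢ b × R a b × e ≡ ⁅ a ⁆ ∪ ⁅ b ⁆
  ; nonempty = λ { _ (a , b , _ , _ , refl) → a , x∈⁅x⁆∪⁅y⁆ a b } }

ProperFor : ∀ {n t} → (Fin n → Fin n → Set) → (Fin n → Fin t) → Set
ProperFor R c = ∀ {a b} → a ≢ b → R a b → c a ≢ c b

module _ {n : ℕ} {R : Fin n → Fin n → Set} where

  graphOf-isGraph : IsGraph (graphOf R)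
  graphOf-isGraph _ (_ , _ , a≢b , _ , refl) = ∣⁅x⁆∪⁅y⁆∣≡2 a≢b

  graphOf-stablePart-edgeless : ∀ {s} →
    (∀ {a b} → R a b → ¬ (s ≤ ∣ toℕ a - toℕ b ∣ × ∣ toℕ a - toℕ b ∣ ≤ n ∸ s)) →
    ∀ e → ¬ IsEdge (stablePart s (graphOf R)) e
  graphOf-stablePart-edgeless unstable _ ((a , b , a≢b , Rab , refl) , stable) =
    unstable Rab (stable a b (x∈⁅x⁆∪⁅y⁆ a b) (y∈⁅x⁆∪⁅y⁆ a b) a≢b)

  graphOf-inducedColourable : ∀ {t S} (c : Fin n → Fin t) →
    (∀ {a b} → a ∉ S → b ∉ S → a ≢ b → R a b → c a ≢ c b) →
    InducedColourable (graphOf R) t S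
  graphOf-inducedColourable c proper =
    (λ i _ → c i) ,
    λ { _ (a , b , a≢b , Rab , refl) disjoint (_ , mono) →
          proper (disjoint a (x∈⁅x⁆∪⁅y⁆ a b)) (disjoint b (y∈⁅x⁆∪⁅y⁆ a b)) a≢b Rab
                 (trans (mono a (x∈⁅x⁆∪⁅y⁆ a b)) (sym (mono b (y∈⁅x⁆∪⁅y⁆ a b)))) }

  inducedColourable-∅⇒proper : ∀ {t} → InducedColourable (graphOf R) t ∅ →
    ∃ λ (c : Fin n → Fin t) → ProperFor R c
  inducedColourable-∅⇒proper (col , noMono) = c , proper
    where
    c : Fin n → Fin _
    c i = col i ∉⊥

    proper : ProperFor R c
    proper {a} {b} a≢b Rab ca≡cb =
      noMono (⁅ a ⁆ ∪ ⁅ b ⁆) (a , b , a≢b , Rab , refl) (λ _ _ → ∉⊥)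
             (c a , λ i i∈ → [ cong c , (λ i≡b → trans (cong c i≡b) (sym ca≡cb)) ]
                               (∈⁅x⁆∪⁅y⁆⇒≡ a b i∈))

KG-edgeless-χ≡0 : ∀ {n r} {F : FinHypergraph n} → (∀ e → ¬ IsEdge F e) →
  IsChromaticNumber (KG (suc r) F) 0
KG-edgeless-χ≡0 noEdge =
  ((λ (e , isEdge) → ⊥-elim (noEdge e isEdge)) ,
   (λ (f , _) _ → noEdge _ (proj₂ (f zero)))) ,
  λ _ ()

colourabilityDefect≡1 : ∀ {n t} {H : FinHypergraph n} (v : Fin n) →
  InducedColourable H t ⁅ v ⁆ → ¬ InducedColourable H t ∅ →
  IsColourabilityDefect H t 1
colourabilityDefect≡1 {t = t} {H} v colourable ¬colourable =
  (⁅ v ⁆ , ∣⁅x⁆∣≡1 v , colourable) , atLeastOne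
  where
  atLeastOne : ∀ S → InducedColourable H t S → 1 ≤ ∣ S ∣
  atLeastOne S colourableS with nonempty? S
  ... | yes (i , i∈S) = subst (_≤ ∣ S ∣) (∣⁅x⁆∣≡1 i)
                          (p⊆q⇒∣p∣≤∣q∣ λ j∈⁅i⁆ → subst (_∈ S) (sym (x∈⁅y⁆⇒x≡y i j∈⁅i⁆)) i∈S)
  ... | no empty = ⊥-elim (¬colourable (subst (InducedColourable H t) (Empty-unique empty) colourableS))

%-≡⇒∣∸ : ∀ {x y} d .{{_ : NonZero d}} → x % d ≡ y % d → d ∣ y ∸ x
%-≡⇒∣∸ {x} {y} d x%d≡y%d = divides (y / d ∸ x / d) (begin
  y ∸ x                                          ≡⟨ cong₂ _∸_ (m≡m%n+[m/n]*n y d) (m≡m%n+[m/n]*n x d) ⟩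
  (y % d + y / d * d) ∸ (x % d + x / d * d)      ≡⟨ cong (λ r → (r + y / d * d) ∸ (x % d + x / d * d)) x%d≡y%d ⟨
  (x % d + y / d * d) ∸ (x % d + x / d * d)      ≡⟨ [m+n]∸[m+o]≡n∸o (x % d) _ _ ⟩
  y / d * d ∸ x / d * d                          ≡⟨ *-distribʳ-∸ d (y / d) (x / d) ⟨
  (y / d ∸ x / d) * d                            ∎)
  where open ≡-Reasoning

∣∧<⇒≤ : ∀ {d m} s → s ∣ d → d < suc m * s → d ≤ m * s
∣∧<⇒≤ {m = m} s (divides-refl q) q*s<[1+m]*s = *-monoˡ-≤ s (s≤s⁻¹ (*-cancelʳ-< s q (suc m) q*s<[1+m]*s))

endpoints⊎∸< : ∀ {a b s} → a < b → b ≤ s → (a ≡ 0 × b ≡ s) ⊎ b ∸ a < s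
endpoints⊎∸< {zero} _ b≤s with m≤n⇒m<n∨m≡n b≤s
... | inj₁ b<s = inj₂ b<s
... | inj₂ b≡s = inj₁ (refl , b≡s)
endpoints⊎∸< {suc a} {suc b} _ b≤s = inj₂ (<-≤-trans (s≤s (m∸n≤m b a)) b≤s)

-- A colouring of 0, 1, …, n - 1 with s colours in which points at distance
-- less than s differ is s-periodic: some two of the s + 1 points i, …, i + s
-- share a colour, and the only pair allowed to do so is i, i + s.
module _ {s n : ℕ} (F : ℕ → Fin s)
         (proper : ∀ {x y} → x < y → y < n → y ∸ x < s → F x ≢ F y) where

  proper⇒periodic : ∀ i → i + s < n → F (i + s) ≡ F i
  proper⇒periodic i i+s<n with pigeonhole (n<1+n s) (λ j → F (i + toℕ j))
  ... | j , j′ , j<j′ , Fj≡Fj′ with endpoints⊎∸< j<j′ (toℕ≤pred[n] j′)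
  ... | inj₁ (j≡0 , j′≡s) = begin
    F (i + s)       ≡⟨ cong (F ∘ (i +_)) j′≡s ⟨
    F (i + toℕ j′)  ≡⟨ Fj≡Fj′ ⟨
    F (i + toℕ j)   ≡⟨ cong (F ∘ (i +_)) j≡0 ⟩
    F (i + 0)       ≡⟨ cong F (+-identityʳ i) ⟩
    F i             ∎
    where open ≡-Reasoning
  ... | inj₂ gap<s = ⊥-elim (proper (+-monoʳ-< i j<j′)
          (≤-<-trans (+-monoʳ-≤ i (toℕ≤pred[n] j′)) i+s<n)
          (subst (_< s) (sym ([m+n]∸[m+o]≡n∸o i _ _)) gap<s) Fj≡Fj′)

  proper⇒F[k*s]≡F[0] : ∀ k → k * s < n → F (k * s) ≡ F 0
  proper⇒F[k*s]≡F[0] zero    _        = refl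
  proper⇒F[k*s]≡F[0] (suc k) [1+k]s<n = begin
    F (s + k * s)  ≡⟨ cong F (+-comm s (k * s)) ⟩
    F (k * s + s)  ≡⟨ proper⇒periodic (k * s) (subst (_< n) (+-comm s (k * s)) [1+k]s<n) ⟩
    F (k * s)      ≡⟨ proper⇒F[k*s]≡F[0] k (≤-<-trans (m≤n+m (k * s) s) [1+k]s<n) ⟩
    F 0            ∎
    where open ≡-Reasoning

Close : ℕ → ℕ → ℕ → ℕ → Set
Close n s x y = ∣ x - y ∣ < s ⊎ n ∸ s < ∣ x - y ∣

Close⇒¬stable : ∀ {n s x y} → Close n s x y → ¬ (s ≤ ∣ x - y ∣ × ∣ x - y ∣ ≤ n ∸ s)
Close⇒¬stable (inj₁ <s)   (s≤ , _) = <⇒≱ <s s≤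
Close⇒¬stable (inj₂ n∸s<) (_ , ≤n∸s) = <⇒≱ n∸s< ≤n∸s

Close-sym : ∀ {n s x y} → Close n s x y → Close n s y x
Close-sym {n} {s} {x} {y} = subst (λ d → d < s ⊎ n ∸ s < d) (∣-∣-comm x y)

module CloseGraph (k-1 s-2 : ℕ) where

  s N n : ℕ
  s = 2 + s-2
  N = suc k-1 * s
  n = suc N

  G : FinHypergraph n
  G = graphOf (λ a b → Close n s (toℕ a) (toℕ b))

  n∸s≡1+[k-1]*s : n ∸ s ≡ suc (k-1 * s)
  n∸s≡1+[k-1]*s = trans (cong (_∸ s) (sym (+-suc s (k-1 * s)))) (m+n∸m≡n s (suc (k-1 * s)))

  toℕ-mod : ∀ {x} → x < n → toℕ (x mod n) ≡ x
  toℕ-mod x<n = trans (toℕ-fromℕ< _) (m<n⇒m%n≡m x<n)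

  ¬proper : ∀ (c : Fin n → Fin s) → ¬ ProperFor (λ a b → Close n s (toℕ a) (toℕ b)) c
  ¬proper c proper = properℕ (s≤s z≤n) ≤-refl (inj₂ n∸s<N)
                       (sym (proper⇒F[k*s]≡F[0] F window (suc k-1) ≤-refl))
    where
    F : ℕ → Fin s
    F x = c (x mod n)

    properℕ : ∀ {x y} → x < y → y < n → Close n s x y → F x ≢ F y
    properℕ {x} {y} x<y y<n close = proper
      (λ eq → <⇒≢ x<y (trans (sym (toℕ-mod (<-trans x<y y<n))) (trans (cong toℕ eq) (toℕ-mod y<n))))
      (subst₂ (Close n s) (sym (toℕ-mod (<-trans x<y y<n))) (sym (toℕ-mod y<n)) close)

    window : ∀ {x y} → x < y → y < n → y ∸ x < s → F x ≢ F y
    window x<y y<n gap<s = properℕ x<y y<n (inj₁ (subst (_< s) (sym (m≤n⇒∣m-n∣≡n∸m (<⇒≤ x<y))) gap<s))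

    n∸s<N : n ∸ s < N
    n∸s<N = subst (_< N) (sym n∸s≡1+[k-1]*s) (s≤s (s≤s (m≤n+m (k-1 * s) s-2)))

  sameResidue⇒¬Close : ∀ {x y} → x < y → y < N → x % s ≡ y % s → ¬ Close n s x y
  sameResidue⇒¬Close {x} {y} x<y y<N x%s≡y%s close =
    [ (λ y∸x<s → <⇒≱ y∸x<s s≤y∸x) , (λ n∸s<y∸x → <⇒≱ n∸s<y∸x y∸x≤n∸s) ]
    (subst (λ d → d < s ⊎ n ∸ s < d) (m≤n⇒∣m-n∣≡n∸m (<⇒≤ x<y)) close)
    where
    s∣y∸x : s ∣ y ∸ x
    s∣y∸x = %-≡⇒∣∸ {x} {y} s x%s≡y%s

    s≤y∸x : s ≤ y ∸ x
    s≤y∸x = ∣⇒≤ {{>-nonZero (m<n⇒0<n∸m x<y)}} s∣y∸x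

    y∸x≤n∸s : y ∸ x ≤ n ∸ s
    y∸x≤n∸s = subst (y ∸ x ≤_) (sym n∸s≡1+[k-1]*s)
                (m≤n⇒m≤1+n (∣∧<⇒≤ {m = k-1} s s∣y∸x (≤-<-trans (m∸n≤m y x) y<N)))

  ∉⁅N⁆⇒<N : ∀ {a : Fin n} → a ∉ ⁅ fromℕ N ⁆ → toℕ a < N
  ∉⁅N⁆⇒<N {a} a∉⁅N⁆ = ≤∧≢⇒< (toℕ≤pred[n] a)
    (λ a≡N → x∉⁅y⁆⇒x≢y a∉⁅N⁆ (toℕ-injective (trans a≡N (sym (toℕ-fromℕ N)))))

  residue : Fin n → Fin s
  residue a = toℕ a mod s

  residue≡⇒%≡ : ∀ {a b} → residue a ≡ residue b → toℕ a % s ≡ toℕ b % s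
  residue≡⇒%≡ {a} {b} residue≡ = trans (sym (toℕ-fromℕ< (m%n<n (toℕ a) s)))
    (trans (cong toℕ residue≡) (toℕ-fromℕ< (m%n<n (toℕ b) s)))

  residue-proper : ∀ {a b} → a ∉ ⁅ fromℕ N ⁆ → b ∉ ⁅ fromℕ N ⁆ → a ≢ b →
    Close n s (toℕ a) (toℕ b) → residue a ≢ residue b
  residue-proper {a} {b} a∉ b∉ a≢b close residue≡ with <-cmp (toℕ a) (toℕ b)
  ... | tri< a<b _ _ = sameResidue⇒¬Close a<b (∉⁅N⁆⇒<N b∉) (residue≡⇒%≡ {a} {b} residue≡) close
  ... | tri≈ _ a≡b _ = a≢b (toℕ-injective a≡b)
  ... | tri> _ _ b<a = sameResidue⇒¬Close b<a (∉⁅N⁆⇒<N a∉) (residue≡⇒%≡ {b} {a} (sym residue≡))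
                         (Close-sym {n} {s} {toℕ a} close)

  stablePart-edgeless : ∀ e → ¬ IsEdge (stablePart s G) e
  stablePart-edgeless = graphOf-stablePart-edgeless λ {a} {b} → Close⇒¬stable {n} {s} {toℕ a} {toℕ b}

  colourable-without-N : InducedColourable G s ⁅ fromℕ N ⁆
  colourable-without-N = graphOf-inducedColourable residue residue-proper

  ¬colourable : ¬ InducedColourable G s ∅
  ¬colourable colourable = let c , proper = inducedColourable-∅⇒proper colourable in ¬proper c proper

  KG[stablePart]-χ≡0 : ∀ r → IsChromaticNumber (KG (suc r) (stablePart s G)) 0
  KG[stablePart]-χ≡0 _ = KG-edgeless-χ≡0 {F = stablePart s G} stablePart-edgeless

  cd≡1 : IsColourabilityDefect G s 1
  cd≡1 = colourabilityDefect≡1 {H = G} (fromℕ N) colourable-without-N ¬colourable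

  k-1<n : k-1 < n
  k-1<n = s≤s (≤-trans (m≤m*n k-1 s) (m≤n+m (k-1 * s) s))

theorem1p14 : (r s l : ℕ) → 2 ≤ r → 2 ≤ s → 2 ≤ l →
    Σ ℕ λ n → l < n × Σ (FinHypergraph n) λ G → IsGraph G ×
    IsChromaticNumber (KG r (stablePart s G)) 0 ×
    Σ ℕ λ d → IsColourabilityDefect G s d × 1 ≤ ⌈ d / (r ∸ 1) ⌉
theorem1p14 (suc (suc r-2)) (suc (suc s-2)) l (s≤s (s≤s z≤n)) (s≤s (s≤s z≤n)) _ =
  n , k-1<n , G , graphOf-isGraph ,
  KG[stablePart]-χ≡0 (suc r-2) ,
  1 , cd≡1 ,
  ≤-reflexive (sym (n/n≡1 (suc r-2)))
  where open CloseGraph l s-2
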